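{- Let $\Pi$ be a finite set of proposition symbols, $I=[a]$ with $a\in\mathbb{Z}_{+}$, and $n\in\mathbb{N}$. Two finite pointed $(\Pi,I)$-models $(M,w)$ and $(N,v)$ satisfy exactly the same full graded multimodal $(\Pi,I)$-types of modal depth $n$ if and only if, for every counting multichannel message passing automaton $A$ for $(\Pi,I)$, $(M,w)$ and $(N,v)$ are in the same state of $A$ in each round $t\le n$.
   Context: $(\Pi,I)$-formulae of $\mathrm{GMML}$: $\varphi ::= \top \mid p \mid \neg\varphi \mid (\varphi\land\varphi)\mid \langle\alpha\rangle_{\geq k}\varphi$ ($p\in\Pi$, $\alpha\in I$, $k\in\mathbb{N}$). A $(\Pi,I)$-model is $M=(W,(R_\alpha)_{\alpha\in I},V)$ with $W\neq\emptyset$, $R_\alpha\subseteq W\times W$, $V:\Pi\to\wp(W)$; a pointed model is $(M,w)$, $w\in W$. Semantics are standard, with $(M,w)\models\langle\alpha\rangle_{\geq k}\psi$ iff $|\{v:(w,v)\in R_\alpha,(M,v)\models\psi\}|\ge k$; $\langle\alpha\rangle_{=k}\psi$ abbreviates $\langle\alpha\rangle_{\geq k}\psi\land\neg\langle\alpha\rangle_{\geq k+1}\psi$. Let $\mathcal{N}^\alpha(w)=\{v:(w,v)\in R_\alpha\}$. Full types: $\tau^{(M,w)}_\varepsilon=\bigwedge_{w\in V(p)}p\land\bigwedge_{w\notin V(p)}\neg p$ (canonical ordering/bracketing; $\top$ if $\Pi=\emptyset$). If types of width $\mathbf{k}=(\mathbf{k}_1,\dots,\mathbf{k}_n)\in(\mathbb{N}^{|I|})^n$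 are defined, $T_{\mathbf{k}}$ is the set of all of them, and for $\mathbf{k}_0=(k_1,\dots,k_{|I|})$, $\tau^{(M,w)}_{(\mathbf{k}_0,\dots,\mathbf{k}_n)}$ is the conjunction of $\tau^{(M,w)}_\varepsilon$, all $\langle\alpha\rangle_{=\ell}\tau$ ($\alpha\in I$, $1\le\ell\le k_\alpha-1$, $\tau\in T_{\mathbf{k}}$) true at $(M,w)$, all $\langle\alpha\rangle_{\ge k_\alpha}\tau$ ($\alpha\in I$, $\tau\in T_{\mathbf{k}}$) true at $(M,w)$, and all $\langle\alpha\rangle_{=|\mathcal{N}^\alpha(w)|}\top$ for $\alpha$ with $k_\alpha>|\mathcal{N}^\alpha(w)|$. The full graded multimodal $(\Pi,I)$-type of depth $0$ of $(M,w)$ is $\tau^{(M,w)}_\varepsilon$; a full type of depth $n+1$ of $(M,w)$ is any $\tau^{(M,w)}_{(\mathbf{k}_1,\dots,\mathbf{k}_{n+1})}$ with $k_{i,\alpha}>\max\{|\mathcal{N}^\alpha(v)|:(w,v)\in(\bigcup_\beta R_\beta)^{i-1}\}$ for all $i\in[n+1]$, $\alpha\in I$. A multiset of $X$ is a function $X\to\mathbb{N}$; $\mathfrak{m}(X)$ is the set of multisets of $X$. A counting multichannel message passing automaton ($\mathrm{CMMPA}$) for $(\Pi,I)$ is $A=(Q,\pi,\delta,F)$ with $Q\neq\emptyset$ a countable set of states, $\pi:\wp(\Pi)\to Q$, $\delta:(\mathfrak{m}(Q))^{|I|}\times Q\to Q$, $F\subseteq Q$. Its run on $M$: $f_0(w)=\pi(\{p\in\Pi:w\in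 V(p)\})$, $f_{t+1}(w)=\delta(N_1,\dots,N_{|I|},f_t(w))$ where $N_\alpha=\{\{f_t(v):(w,v)\in R_\alpha\}\}$ (multiset). The state of $(M,w)$ in round $t$ is $f_t(w)$. -}

module Defs where

open import Data.Nat using (ℕ; zero; suc; _+_; _≤_; _<_; _≤ᵇ_; _≟_)
open import Data.Bool using (Bool; true; false; not; _∧_; if_then_else_)
open import Data.Fin using (Fin; toℕ; zero; suc)
open import Data.Fin.Subset using (Subset)
open import Data.Vec using (Vec; []; _∷_; tabulate; lookup)
open import Data.List using (List; []; _∷_; map; allFin)
open import Data.List.Membership.Propositional using (_∈_)
open import Data.List.Relation.Unary.Unique.Propositional using (Unique)
open import Data.Product using (Σ; ∃; _×_; _,_)
open import Data.Sum using (_⊎_)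
open import Function using (_⇔_)
open import Function.Definitions using (Injective)
open import Relation.Binary.PropositionalEquality using (_≡_)
open import Relation.Nullary.Decidable using (⌊_⌋)

-- Syntax of GMML over Π = Fin m (proposition symbols), I = Fin a (channels)

data Formula (m a : ℕ) : Set where
  ⊤'   : Formula m a
  prop : Fin m → Formula m a
  ¬'_  : Formula m a → Formula m a
  _∧'_ : Formula m a → Formula m a → Formula m a
  ⟨_⟩≥_∙_ : Fin a → ℕ → Formula m a → Formula m a

⟨_⟩=_∙_ : ∀ {m a} → Fin a → ℕ → Formula m a → Formula m a
⟨ α ⟩= k ∙ ψ = (⟨ α ⟩≥ k ∙ ψ) ∧' (¬' (⟨ α ⟩≥ suc k ∙ ψ))

⋀ : ∀ {m a} → List (Formula m a) → Formula m a
⋀ []           = ⊤'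
⋀ (x ∷ [])     = x
⋀ (x ∷ y ∷ xs) = x ∧' ⋀ (y ∷ xs)

-- Finite (Π,I)-models: W = Fin size (nonempty since models are pointed)

record Model (m a : ℕ) : Set where
  field
    size : ℕ
    R    : Fin a → Fin size → Fin size → Bool
    V    : Fin m → Fin size → Bool
open Model public

countFin : ∀ {s} → (Fin s → Bool) → ℕ
countFin {zero}  P = 0
countFin {suc s} P = (if P zero then 1 else 0) + countFin (λ i → P (suc i))

deg : ∀ {m a} (M : Model m a) → Fin a → Fin (size M) → ℕ
deg M α w = countFin (λ v → R M α w v)

eval : ∀ {m a} (M : Model m a) → Formula m a → Fin (size M) → Bool
eval M ⊤'               w = true
eval M (prop p)         w = V M p w
eval M (¬' φ)           w = not (eval M φ w)
eval M (φ ∧' ψ)         w = eval M φ w ∧ eval M ψ w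
eval M (⟨ α ⟩≥ k ∙ ψ)   w = k ≤ᵇ countFin (λ v → R M α w v ∧ eval M ψ v)

_,_⊨_ : ∀ {m a} (M : Model m a) → Fin (size M) → Formula m a → Set
M , w ⊨ φ = eval M φ w ≡ true

data Reach {m a} (M : Model m a) : ℕ → Fin (size M) → Fin (size M) → Set where
  here : ∀ {w} → Reach M 0 w w
  step : ∀ {j w v u} (β : Fin a) → R M β w v ≡ true → Reach M j v u → Reach M (suc j) w u

literal : ∀ {m a} (M : Model m a) → Fin (size M) → Fin m → Formula m a
literal M w p = if V M p w then prop p else ¬' prop p

τε : ∀ {m a} (M : Model m a) → Fin (size M) → Formula m a
τε {m} M w = ⋀ (map (literal M w) (allFin m))

-- A width is a vector (k_1,...,k_n) of elements of ℕ^{|I|}.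
-- IsType ks M w φ : φ is τ^{(M,w)}_{ks}  (with the conjuncts listed in some
-- duplicate-free order)
-- InT ks φ        : φ ∈ T_{ks}, i.e. φ is a type of width ks of some finite pointed model
mutual
  IsType : ∀ {m a n} → Vec (Fin a → ℕ) n → (M : Model m a) → Fin (size M) → Formula m a → Set
  IsType [] M w φ = φ ≡ τε M w
  IsType (k₀ ∷ ks) M w φ =
    Σ (List (Formula _ _)) λ L →
      Unique L × (∀ ψ → (ψ ∈ L) ⇔ Conjunct k₀ ks M w ψ) × (φ ≡ ⋀ L)

  InT : ∀ {m a n} → Vec (Fin a → ℕ) n → Formula m a → Set
  InT {m} {a} ks φ = Σ (Model m a) λ K → Σ (Fin (size K)) λ u → IsType ks K u φ

  Conjunct : ∀ {m a n} → (Fin a → ℕ) → Vec (Fin a → ℕ) n → (M : Model m a) → Fin (size M) → Formula m a → Set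
  Conjunct k₀ ks M w ψ =
      (ψ ≡ τε M w)
    ⊎ (Σ _ λ α → Σ ℕ λ ℓ → Σ _ λ τ →
         1 ≤ ℓ × suc ℓ ≤ k₀ α × InT ks τ × ψ ≡ (⟨ α ⟩= ℓ ∙ τ) × M , w ⊨ ψ)
    ⊎ (Σ _ λ α → Σ _ λ τ →
         InT ks τ × ψ ≡ (⟨ α ⟩≥ k₀ α ∙ τ) × M , w ⊨ ψ)
    ⊎ (Σ _ λ α → deg M α w < k₀ α × ψ ≡ (⟨ α ⟩= deg M α w ∙ ⊤'))

FullType : ∀ {m a} (n : ℕ) (M : Model m a) → Fin (size M) → Formula m a → Set
FullType {m} {a} n M w φ =
  Σ (Vec (Fin a → ℕ) n) λ ks →
    (∀ (i : Fin n) (α : Fin a) (v : Fin (size M)) →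
       Reach M (toℕ i) w v → deg M α v < lookup ks i α)
    × IsType ks M w φ

SameFullTypes : ∀ {m a} (n : ℕ) (M : Model m a) → Fin (size M) → (N : Model m a) → Fin (size N) → Set
SameFullTypes {m} {a} n M w N v =
  ∀ (φ : Formula m a) →
    (Σ (Model m a) λ K → Σ (Fin (size K)) λ u → FullType n K u φ) →
    (M , w ⊨ φ) ⇔ (N , v ⊨ φ)

Multiset : Set → Set
Multiset X = X → ℕ

record CMMPA (m a : ℕ) : Set₁ where
  field
    Q        : Set
    -- Q is countable
    code     : Q → ℕ
    code-inj : Injective _≡_ _≡_ code
    π        : Subset m → Q
    δ        : (Fin a → Multiset Q) → Q → Q
    -- δ is a function on multisets, i.e. respects (pointwise) equality of multisets
    δ-cong   : ∀ (N N' : Fin a → Multiset Q) (q : Q) →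
               (∀ α x → N α x ≡ N' α x) → δ N q ≡ δ N' q
    F        : Q → Bool
open CMMPA public

run : ∀ {m a} (A : CMMPA m a) (M : Model m a) → ℕ → Fin (size M) → Q A
run A M zero    w = π A (tabulate (λ p → V M p w))
run A M (suc t) w =
  δ A (λ α q → countFin (λ v → R M α w v ∧ ⌊ code A (run A M t v) ≟ code A q ⌋))
      (run A M t w)

{-# OPTIONS --safe #-}
-- Fix a bound b above every degree of M and take a full type σ of (M,w) of depth n
-- all of whose widths are b; then (N,v) ⊨ σ. By induction on d, a point satisfying the
-- depth-d type of a point x of M satisfies exactly the depth-d types that x satisfies:
-- the conjuncts ⟨α⟩_{=ℓ} τ of σ fix, for every type τ of depth d-1, the number of
-- α-successors realising τ, and peeling off one type class at a time shows that every
-- union of classes has the same number of α-successors. The state of any CMMPA in round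
-- t ≤ d is constant on these classes (induction on t), so successor multisets and hence
-- runs agree. Conversely, a formula of modal depth ≤ n is evaluated in round n by a CMMPA
-- whose states are truth vectors of its subformulas, and full types of depth n have
-- modal depth ≤ n.
--
-- The sets T_k of types are defined by quantifying over all models, so the conjuncts of
-- a type cannot be computed and the type of a point exists only under double negation.
-- This is harmless: everything concluded from it is an equation between natural numbers
-- or between automaton states, which are decidable.
module Submission where

open import Defs
open import Algebra.Bundles using (CommutativeMonoid)
open import Data.Bool using (Bool; true; false; not; _∧_; if_then_else_)
open import Data.Bool.Properties using (∧-commutativeMonoid; ¬-not)
import Data.Bool.Properties as Bool
open import Data.Empty using (⊥-elim)
open import Data.Fin using (Fin; zero; suc; toℕ; funToFin; finToFun; combine)
open import Data.Fin.Properties using (any?; finToFun-funToFin; toℕ-injective)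
import Data.Fin.Properties as Fin
open import Data.Fin.Subset using (Subset)
open import Data.List
  using (List; []; _∷_; _++_; map; allFin; concatMap; filter; length; tabulate; upTo; deduplicate)
import Data.List as List
open import Data.List.Properties using (filter-notAll; map-cong)
open import Data.List.Membership.Propositional using (_∈_)
open import Data.List.Membership.Propositional.Properties
  using (∈-++⁺ʳ; ∈-++⁺ˡ; ∈-++⁻; ∈-map⁺; ∈-map⁻; ∈-allFin; ∈-concat⁺′; ∈-filter⁺; ∈-tabulate⁺; ∈-upTo⁺;
         ∈-deduplicate⁺; ∈-deduplicate⁻)
import Data.List.Relation.Unary.All as All
open import Data.List.Relation.Unary.AllPairs using (_∷_)
open import Data.List.Relation.Unary.Any using (here; there)
import Data.List.Relation.Unary.Any as Any
open import Data.List.Relation.Unary.Unique.Propositional using (Unique)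
open import Data.List.Relation.Unary.Unique.DecPropositional.Properties using (deduplicate-!)
open import Data.Nat using (ℕ; zero; suc; _+_; _⊔_; _≤_; _<_; _≤ᵇ_; _≟_; _^_; z≤n; s≤s)
open import Data.Nat.Properties
  using (+-0-commutativeMonoid; +-suc; +-identityʳ; +-cancelˡ-≡; +-monoˡ-≤; ≤-refl; ≤-trans; ≤-antisym;
         ≤-pred; ≤-<-trans; <-irrefl; ≤ᵇ⇒≤; ≤⇒≤ᵇ; ≮⇒≥; n≤0⇒n≡0; m≤n+m; m≤m+n; m≤n⇒m≤1+n; ⊔-lub;
         m⊔n≤o⇒m≤o; m⊔n≤o⇒n≤o)
open import Data.Product using (Σ; ∃; _×_; _,_; proj₁; proj₂)
open import Data.Sum using (inj₁; inj₂)
open import Data.Vec using (Vec; []; _∷_)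
import Data.Vec as Vec
open import Data.Vec.Properties using (lookup∘tabulate; tabulate-cong; lookup-replicate)
open import Effect.Monad using (RawMonad)
open import Function using (_∘_; _$_; _⇔_; Equivalence; mk⇔; case_of_)
open Equivalence using (to; from)
open import Level using (0ℓ)
open import Relation.Binary.Definitions using (DecidableEquality)
open import Relation.Binary.PropositionalEquality
  using (_≡_; _≢_; _≗_; refl; sym; trans; cong; cong₂; subst; module ≡-Reasoning)
open import Relation.Nullary using (¬_; ¬?; Dec; yes; no; contradiction)
open import Relation.Nullary.Decidable
  using (⌊_⌋; isYes≗does; map′; _×-dec_; ¬¬-excluded-middle; decidable-stable)
open import Relation.Nullary.Negation using (DoubleNegation; ¬¬-Monad)
open import Algebra.Properties.CommutativeSemigroup
  (CommutativeMonoid.commutativeSemigroup ∧-commutativeMonoid) using (xy∙z≈xz∙y; x∙yz≈z∙yx)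
open import Algebra.Properties.CommutativeMonoid.Sum +-0-commutativeMonoid
  using (sum-syntax; ∑-comm; sum-cong-≗; sum-replicate-zero)

∧≡true⇔ : ∀ {x y} → (x ∧ y ≡ true) ⇔ (x ≡ true × y ≡ true)
∧≡true⇔ {true}  = mk⇔ (refl ,_) proj₂
∧≡true⇔ {false} = mk⇔ (λ ()) λ { (() , _) }

≤ᵇ≡true⇔≤ : ∀ {m n} → ((m ≤ᵇ n) ≡ true) ⇔ (m ≤ n)
≤ᵇ≡true⇔≤ {m} {n} = mk⇔ (≤ᵇ⇒≤ m n ∘ from Bool.T-≡) (to Bool.T-≡ ∘ ≤⇒≤ᵇ)

exactly⇔≡ : ∀ j c → ((j ≤ᵇ c) ∧ not (suc j ≤ᵇ c) ≡ true) ⇔ (c ≡ j)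
exactly⇔≡ j c with j ≤ᵇ c in j≤ᵇc | suc j ≤ᵇ c in j<ᵇc
... | true  | false = mk⇔ (λ _ → ≤-antisym (≮⇒≥ j≮c) (to ≤ᵇ≡true⇔≤ j≤ᵇc)) (λ _ → refl)
  where
  j≮c : ¬ (j < c)
  j≮c j<c with () ← trans (sym j<ᵇc) (from ≤ᵇ≡true⇔≤ j<c)
... | true  | true  = mk⇔ (λ ()) λ { refl → ⊥-elim (<-irrefl refl (to (≤ᵇ≡true⇔≤ {suc j}) j<ᵇc)) }
... | false | _     =
  mk⇔ (λ ()) λ { refl → case trans (sym j≤ᵇc) (from (≤ᵇ≡true⇔≤ {j}) ≤-refl) of λ () }

infixl 7 _∩_ _∖_

_∩_ _∖_ : ∀ {s} → (Fin s → Bool) → (Fin s → Bool) → Fin s → Bool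
(P ∩ Q) i = P i ∧ Q i
(P ∖ Q) i = P i ∧ not (Q i)

countFin-cong : ∀ {s} {P Q : Fin s → Bool} → P ≗ Q → countFin P ≡ countFin Q
countFin-cong {zero}  P≗Q = refl
countFin-cong {suc s} P≗Q =
  cong₂ _+_ (cong (λ b → if b then 1 else 0) (P≗Q zero)) (countFin-cong (P≗Q ∘ suc))

countFin-false : ∀ s → countFin {s} (λ _ → false) ≡ 0
countFin-false zero    = refl
countFin-false (suc s) = countFin-false s

countFin-≤ : ∀ {s} (P : Fin s → Bool) → countFin P ≤ s
countFin-≤ {zero}  P = z≤n
countFin-≤ {suc s} P with P zero
... | true  = s≤s (countFin-≤ (P ∘ suc))
... | false = m≤n⇒m≤1+n (countFin-≤ (P ∘ suc))

countFin-pos : ∀ {s} (P : Fin s → Bool) {i} → P i ≡ true → 1 ≤ countFin P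
countFin-pos P {zero}  Pi rewrite Pi = s≤s z≤n
countFin-pos P {suc i} Pi = ≤-trans (countFin-pos (P ∘ suc) Pi) (m≤n+m _ _)

countFin-split : ∀ {s} (P Q : Fin s → Bool) → countFin P ≡ countFin (P ∩ Q) + countFin (P ∖ Q)
countFin-split {zero}  P Q = refl
countFin-split {suc s} P Q with P zero | Q zero | countFin-split (P ∘ suc) (Q ∘ suc)
... | false | _     | ih = ih
... | true  | true  | ih = cong suc ih
... | true  | false | ih = trans (cong suc ih) (sym (+-suc _ _))

countFin-split-∩ : ∀ {s} (P D h : Fin s → Bool) →
                   countFin (P ∩ h) ≡ countFin ((P ∩ D) ∩ h) + countFin ((P ∖ D) ∩ h)
countFin-split-∩ P D h = trans (countFin-split (P ∩ h) D)
  (cong₂ _+_ (countFin-cong λ i → xy∙z≈xz∙y (P i) (h i) (D i))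
             (countFin-cong λ i → xy∙z≈xz∙y (P i) (h i) (not (D i))))

countFin-∩-≤ : ∀ {s} (P Q : Fin s → Bool) → countFin (P ∩ Q) ≤ countFin P
countFin-∩-≤ P Q = subst (countFin (P ∩ Q) ≤_) (sym (countFin-split P Q)) (m≤m+n _ _)

countFin-∩-const : ∀ {s} (P g : Fin s → Bool) {b} → (∀ i → P i ≡ true → g i ≡ b) →
                   countFin (P ∩ g) ≡ (if b then countFin P else 0)
countFin-∩-const {zero}  P g {true}  g≡b = refl
countFin-∩-const {zero}  P g {false} g≡b = refl
countFin-∩-const {suc s} P g {b} g≡b
  with P zero in P0 | countFin-∩-const (P ∘ suc) (g ∘ suc) (g≡b ∘ suc)
... | false | ih = ih
... | true  | ih rewrite g≡b zero P0 with b
...   | true  = cong suc ih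
...   | false = ih

countFin-∖-disjoint : ∀ {s} (P D E : Fin s → Bool) → (∀ i → E i ≡ true → D i ≡ false) →
                      countFin ((P ∖ D) ∩ E) ≡ countFin (P ∩ E)
countFin-∖-disjoint P D E disjoint = countFin-cong λ i → lemma (P i) (D i) (E i) (disjoint i)
  where
  lemma : ∀ p d e → (e ≡ true → d ≡ false) → (p ∧ not d) ∧ e ≡ p ∧ e
  lemma false d     e     _  = refl
  lemma true  d     false _  = Bool.∧-zeroʳ (not d)
  lemma true  false true  _  = refl
  lemma true  true  true  d≡ = case d≡ refl of λ ()

countFin-∑ : ∀ {s} (P : Fin s → Bool) → countFin P ≡ ∑[ i < s ] (if P i then 1 else 0)
countFin-∑ {zero}  P = refl
countFin-∑ {suc s} P = cong ((if P zero then 1 else 0) +_) (countFin-∑ (P ∘ suc))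

∑-select : ∀ {K} (x : Fin K) (h : Fin K → Bool) →
           ∑[ q < K ] (if ⌊ toℕ x ≟ toℕ q ⌋ ∧ h q then 1 else 0) ≡ (if h x then 1 else 0)
∑-select {suc K} zero    h = trans (cong ((if h zero then 1 else 0) +_) (sum-replicate-zero K)) (+-identityʳ _)
∑-select {suc K} (suc x) h =
  trans (sum-cong-≗ λ q → cong (λ b → if b ∧ h (suc q) then 1 else 0) (⌊suc≟suc⌋ (toℕ x) (toℕ q)))
        (∑-select x (h ∘ suc))
  where
  -- ⌊_⌋ is stuck on open terms, unlike the underlying does.
  ⌊suc≟suc⌋ : ∀ m n → ⌊ suc m ≟ suc n ⌋ ≡ ⌊ m ≟ n ⌋
  ⌊suc≟suc⌋ m n = trans (isYes≗does (suc m ≟ suc n)) (sym (isYes≗does (m ≟ n)))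

count-by-state : ∀ {S K} (R : Fin S → Bool) (r : Fin S → Fin K) (P : Fin K → Bool) →
  ∑[ q < K ] (if P q then countFin (λ v → R v ∧ ⌊ toℕ (r v) ≟ toℕ q ⌋) else 0)
  ≡ countFin (λ v → R v ∧ P (r v))
count-by-state {S} {K} R r P = begin
  ∑[ q < K ] (if P q then countFin (λ v → R v ∧ same v q) else 0)
    ≡⟨ sum-cong-≗ (λ q → trans (if-countFin (P q)) (countFin-∑ (λ v → P q ∧ (R v ∧ same v q)))) ⟩
  ∑[ q < K ] ∑[ v < S ] [ P q ∧ (R v ∧ same v q) ]
    ≡⟨ ∑-comm (λ q v → [ P q ∧ (R v ∧ same v q) ]) ⟩
  ∑[ v < S ] ∑[ q < K ] [ P q ∧ (R v ∧ same v q) ]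
    ≡⟨ sum-cong-≗ (λ v → sum-cong-≗ λ q → cong [_] (x∙yz≈z∙yx (P q) (R v) (same v q))) ⟩
  ∑[ v < S ] ∑[ q < K ] [ same v q ∧ (R v ∧ P q) ]
    ≡⟨ sum-cong-≗ (λ v → ∑-select (r v) (λ q → R v ∧ P q)) ⟩
  ∑[ v < S ] [ R v ∧ P (r v) ]
    ≡⟨ countFin-∑ (λ v → R v ∧ P (r v)) ⟨
  countFin (λ v → R v ∧ P (r v)) ∎
  where
  open ≡-Reasoning
  [_] : Bool → ℕ
  [ b ] = if b then 1 else 0
  same : Fin S → Fin K → Bool
  same v q = ⌊ toℕ (r v) ≟ toℕ q ⌋
  if-countFin : ∀ b {f : Fin S → Bool} → (if b then countFin f else 0) ≡ countFin (λ v → b ∧ f v)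
  if-countFin true  = refl
  if-countFin false = sym (countFin-false S)

module ClassCounting {s s′ : ℕ}
  (Class : Fin s → Fin s → Bool) (Class′ : Fin s → Fin s′ → Bool)
  (Class-refl     : ∀ x → Class x x ≡ true)
  (Class-overlap  : ∀ {x₁ x₂ z} → Class x₁ z ≡ true → Class x₂ z ≡ true → Class x₁ x₂ ≡ true)
  (Class′-overlap : ∀ {x₁ x₂ y} → Class′ x₁ y ≡ true → Class′ x₂ y ≡ true → Class x₁ x₂ ≡ true)
  (g : Fin s → Bool) (g′ : Fin s′ → Bool)
  (g-const  : ∀ {x z} → Class x z ≡ true → g z ≡ g x)
  (g′-const : ∀ {x y} → Class′ x y ≡ true → g′ y ≡ g x)
  where

  private
    empty : ∀ {t} (P h : Fin t → Bool) → countFin P ≡ 0 → countFin (P ∩ h) ≡ 0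
    empty P h |P|≡0 = n≤0⇒n≡0 (subst (countFin (P ∩ h) ≤_) |P|≡0 (countFin-∩-≤ P h))

    both-empty : ∀ P P′ → countFin P ≡ 0 → countFin P ≡ countFin P′ →
                 countFin (P ∩ g) ≡ countFin (P′ ∩ g′)
    both-empty P P′ |P|≡0 |P|≡|P′| =
      trans (empty P g |P|≡0) (sym (empty P′ g′ (trans (sym |P|≡|P′|) |P|≡0)))

  -- Class x and Class′ x are the classes of x among the points of either side. Peel off
  -- the class of some x₀ ∈ P on both sides: g is constant on it and the two classes have
  -- the same size.
  count-classes : ∀ n (P : Fin s → Bool) (P′ : Fin s′ → Bool) →
                  countFin P ≤ n → countFin P ≡ countFin P′ →
                  (∀ x → P x ≡ true → countFin (P ∩ Class x) ≡ countFin (P′ ∩ Class′ x)) →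
                  countFin (P ∩ g) ≡ countFin (P′ ∩ g′)
  count-classes zero    P P′ |P|≤0 |P|≡|P′| _ = both-empty P P′ (n≤0⇒n≡0 |P|≤0) |P|≡|P′|
  count-classes (suc n) P P′ |P|≤n |P|≡|P′| classes with any? (λ x → P x Bool.≟ true)
  ... | no ∄x =
    both-empty P P′ (trans (countFin-cong λ x → ¬-not (∄x ∘ (x ,_))) (countFin-false s)) |P|≡|P′|
  ... | yes (x₀ , Px₀) = begin
    countFin (P ∩ g)                                           ≡⟨ countFin-split-∩ P (Class x₀) g ⟩
    countFin ((P ∩ Class x₀) ∩ g) + countFin (P₁ ∩ g)         ≡⟨ cong₂ _+_ class₀ rest ⟩
    countFin ((P′ ∩ Class′ x₀) ∩ g′) + countFin (P₁′ ∩ g′)    ≡⟨ countFin-split-∩ P′ (Class′ x₀) g′ ⟨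
    countFin (P′ ∩ g′)                                         ∎
    where
    open ≡-Reasoning
    P₁ = P ∖ Class x₀
    P₁′ = P′ ∖ Class′ x₀
    c₀ = countFin (P ∩ Class x₀)
    c₀′ = countFin (P′ ∩ Class′ x₀)
    c₀≡c₀′ = classes x₀ Px₀

    class₀ : countFin ((P ∩ Class x₀) ∩ g) ≡ countFin ((P′ ∩ Class′ x₀) ∩ g′)
    class₀ = begin
      countFin ((P ∩ Class x₀) ∩ g)
        ≡⟨ countFin-∩-const (P ∩ Class x₀) g (λ z Pz → g-const (proj₂ (to ∧≡true⇔ Pz))) ⟩
      (if g x₀ then c₀ else 0)
        ≡⟨ cong (λ c → if g x₀ then c else 0) c₀≡c₀′ ⟩
      (if g x₀ then c₀′ else 0)
        ≡⟨ countFin-∩-const (P′ ∩ Class′ x₀) g′ (λ y P′y → g′-const (proj₂ (to ∧≡true⇔ P′y))) ⟨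
      countFin ((P′ ∩ Class′ x₀) ∩ g′) ∎

    |P₁|≤n : countFin P₁ ≤ n
    |P₁|≤n = ≤-pred (≤-trans
      (+-monoˡ-≤ (countFin P₁) (countFin-pos (P ∩ Class x₀) (from ∧≡true⇔ (Px₀ , Class-refl x₀))))
      (subst (_≤ suc n) (countFin-split P (Class x₀)) |P|≤n))

    |P₁|≡|P₁′| : countFin P₁ ≡ countFin P₁′
    |P₁|≡|P₁′| = +-cancelˡ-≡ c₀ _ _ (begin
      c₀ + countFin P₁     ≡⟨ countFin-split P (Class x₀) ⟨
      countFin P           ≡⟨ |P|≡|P′| ⟩
      countFin P′          ≡⟨ countFin-split P′ (Class′ x₀) ⟩
      c₀′ + countFin P₁′   ≡⟨ cong (_+ countFin P₁′) c₀≡c₀′ ⟨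
      c₀ + countFin P₁′    ∎)

    classes₁ : ∀ x → P₁ x ≡ true → countFin (P₁ ∩ Class x) ≡ countFin (P₁′ ∩ Class′ x)
    classes₁ x P₁x = begin
      countFin (P₁ ∩ Class x)
        ≡⟨ countFin-∖-disjoint P (Class x₀) (Class x) (λ z Cxz → ¬-not λ Cx₀z →
             x∉C₀ (Class-overlap Cx₀z Cxz)) ⟩
      countFin (P ∩ Class x)
        ≡⟨ classes x (proj₁ (to ∧≡true⇔ P₁x)) ⟩
      countFin (P′ ∩ Class′ x)
        ≡⟨ countFin-∖-disjoint P′ (Class′ x₀) (Class′ x) (λ y Cxy → ¬-not λ Cx₀y →
             x∉C₀ (Class′-overlap Cx₀y Cxy)) ⟨
      countFin (P₁′ ∩ Class′ x) ∎
      where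
      x∉C₀ : Class x₀ x ≢ true
      x∉C₀ Cx₀x with () ← trans (sym (cong not Cx₀x)) (proj₂ (to ∧≡true⇔ P₁x))

    rest : countFin (P₁ ∩ g) ≡ countFin (P₁′ ∩ g′)
    rest = count-classes n P₁ P₁′ |P₁|≤n |P₁|≡|P₁′| classes₁

-- Bit vectors as elements of Fin (2 ^ n)

bit : Bool → Fin 2
bit false = zero
bit true  = suc zero

isSet : Fin 2 → Bool
isSet zero    = false
isSet (suc _) = true

encode : ∀ {n} → (Fin n → Bool) → Fin (2 ^ n)
encode f = funToFin (bit ∘ f)

decode : ∀ {n} → Fin (2 ^ n) → Fin n → Bool
decode {n} q i = isSet (finToFun {2} {n} q i)

decode-encode : ∀ {n} (f : Fin n → Bool) → decode (encode f) ≗ f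
decode-encode f i = trans (cong isSet (finToFun-funToFin (bit ∘ f) i)) (isSet-bit (f i))
  where
  isSet-bit : ∀ b → isSet (bit b) ≡ b
  isSet-bit false = refl
  isSet-bit true  = refl

encode-cong : ∀ {n} {f g : Fin n → Bool} → f ≗ g → encode f ≡ encode g
encode-cong {zero}  f≗g = refl
encode-cong {suc n} f≗g = cong₂ combine (cong bit (f≗g zero)) (encode-cong (f≗g ∘ suc))

open RawMonad (¬¬-Monad {0ℓ})

¬¬-finite-choice : ∀ n {B : Fin n → Set} → (∀ i → DoubleNegation (B i)) → DoubleNegation (∀ i → B i)
¬¬-finite-choice zero    ¬¬B = pure λ ()
¬¬-finite-choice (suc n) ¬¬B = do
  b₀ ← ¬¬B zero
  bs ← ¬¬-finite-choice n (¬¬B ∘ suc)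
  pure λ { zero → b₀ ; (suc i) → bs i }

¬¬-filter : ∀ {X : Set} (Q : X → Set) (xs : List X) →
            DoubleNegation (Σ (List X) λ ys → ∀ x → (x ∈ ys) ⇔ (x ∈ xs × Q x))
¬¬-filter Q []       = pure ([] , λ _ → mk⇔ (λ ()) (λ ()))
¬¬-filter Q (x ∷ xs) = do
  (ys , ys⇔) ← ¬¬-filter Q xs
  Qx? ← ¬¬-excluded-middle
  pure (extend ys ys⇔ Qx?)
  where
  later : ∀ {ys y} → y ∈ ys ⇔ (y ∈ xs × Q y) → y ∈ ys → y ∈ x ∷ xs × Q y
  later ys⇔ y∈ys = let (y∈xs , Qy) = to ys⇔ y∈ys in there y∈xs , Qy
  extend : ∀ ys → (∀ y → y ∈ ys ⇔ (y ∈ xs × Q y)) → Dec (Q x) →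
           Σ (List _) λ zs → ∀ y → y ∈ zs ⇔ (y ∈ x ∷ xs × Q y)
  extend ys ys⇔ (yes Qx) = x ∷ ys , λ y → mk⇔
    (λ { (here refl) → here refl , Qx ; (there y∈ys) → later (ys⇔ y) y∈ys })
    (λ { (here refl , _) → here refl ; (there y∈xs , Qy) → there (from (ys⇔ y) (y∈xs , Qy)) })
  extend ys ys⇔ (no ¬Qx) = ys , λ y → mk⇔
    (later (ys⇔ y))
    (λ { (here refl , Qx) → contradiction Qx ¬Qx ; (there y∈xs , Qy) → from (ys⇔ y) (y∈xs , Qy) })

module UniqueLists {X : Set} (_≟_ : DecidableEquality X) where

  uniqueLists : ℕ → List X → List (List X)
  uniqueLists zero    xs = [] ∷ []
  uniqueLists (suc n) xs = [] ∷ concatMap (λ x → map (x ∷_) (uniqueLists n (filter (¬? ∘ (x ≟_)) xs))) xs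

  ∈-uniqueLists : ∀ {n xs ys} → Unique ys → (∀ y → y ∈ ys → y ∈ xs) → length xs ≤ n →
                  ys ∈ uniqueLists n xs
  ∈-uniqueLists {zero}  {ys = []}    _            _     _      = here refl
  ∈-uniqueLists {suc n} {ys = []}    _            _     _      = here refl
  ∈-uniqueLists {zero}  {[]} {y ∷ _} _            ys⊆xs _      with () ← ys⊆xs y (here refl)
  ∈-uniqueLists {suc n} {xs} {y ∷ ys} (y∉ys ∷ ys!) ys⊆xs |xs|≤n =
    there (∈-concat⁺′ (∈-map⁺ (y ∷_) (∈-uniqueLists ys! ys⊆xs′ |xs′|≤n)) (∈-map⁺ _ y∈xs))
    where
    y∈xs = ys⊆xs y (here refl)
    xs′ = filter (¬? ∘ (y ≟_)) xs
    ys⊆xs′ : ∀ z → z ∈ ys → z ∈ xs′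
    ys⊆xs′ z z∈ys = ∈-filter⁺ (¬? ∘ (y ≟_)) (ys⊆xs z (there z∈ys)) (All.lookup y∉ys z∈ys)
    |xs′|≤n : length xs′ ≤ n
    |xs′|≤n = ≤-pred (≤-trans (filter-notAll (¬? ∘ (y ≟_)) xs (Any.map (λ { refl y≢y → y≢y refl }) y∈xs)) |xs|≤n)

module _ {m a : ℕ} where

  infix 4 _≟ᶠ_

  _≟ᶠ_ : DecidableEquality (Formula m a)
  ⊤'             ≟ᶠ ⊤'             = yes refl
  prop p         ≟ᶠ prop q         = map′ (cong prop) (λ { refl → refl }) (p Fin.≟ q)
  (¬' φ)         ≟ᶠ (¬' ψ)         = map′ (cong ¬'_) (λ { refl → refl }) (φ ≟ᶠ ψ)
  (φ ∧' φ′)      ≟ᶠ (ψ ∧' ψ′)      =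
    map′ (λ { (refl , refl) → refl }) (λ { refl → refl , refl }) ((φ ≟ᶠ ψ) ×-dec (φ′ ≟ᶠ ψ′))
  (⟨ α ⟩≥ k ∙ φ) ≟ᶠ (⟨ β ⟩≥ l ∙ ψ) =
    map′ (λ { (refl , refl , refl) → refl }) (λ { refl → refl , refl , refl })
         ((α Fin.≟ β) ×-dec (k ≟ l) ×-dec (φ ≟ᶠ ψ))
  ⊤'             ≟ᶠ prop _         = no λ ()
  ⊤'             ≟ᶠ (¬' _)         = no λ ()
  ⊤'             ≟ᶠ (_ ∧' _)       = no λ ()
  ⊤'             ≟ᶠ (⟨ _ ⟩≥ _ ∙ _) = no λ ()
  prop _         ≟ᶠ ⊤'             = no λ ()
  prop _         ≟ᶠ (¬' _)         = no λ ()
  prop _         ≟ᶠ (_ ∧' _)       = no λ ()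
  prop _         ≟ᶠ (⟨ _ ⟩≥ _ ∙ _) = no λ ()
  (¬' _)         ≟ᶠ ⊤'             = no λ ()
  (¬' _)         ≟ᶠ prop _         = no λ ()
  (¬' _)         ≟ᶠ (_ ∧' _)       = no λ ()
  (¬' _)         ≟ᶠ (⟨ _ ⟩≥ _ ∙ _) = no λ ()
  (_ ∧' _)       ≟ᶠ ⊤'             = no λ ()
  (_ ∧' _)       ≟ᶠ prop _         = no λ ()
  (_ ∧' _)       ≟ᶠ (¬' _)         = no λ ()
  (_ ∧' _)       ≟ᶠ (⟨ _ ⟩≥ _ ∙ _) = no λ ()
  (⟨ _ ⟩≥ _ ∙ _) ≟ᶠ ⊤'             = no λ ()
  (⟨ _ ⟩≥ _ ∙ _) ≟ᶠ prop _         = no λ ()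
  (⟨ _ ⟩≥ _ ∙ _) ≟ᶠ (¬' _)         = no λ ()
  (⟨ _ ⟩≥ _ ∙ _) ≟ᶠ (_ ∧' _)       = no λ ()

  depth : Formula m a → ℕ
  depth ⊤'             = 0
  depth (prop _)       = 0
  depth (¬' φ)         = depth φ
  depth (φ ∧' ψ)       = depth φ ⊔ depth ψ
  depth (⟨ _ ⟩≥ _ ∙ φ) = suc (depth φ)

  mutual
    subformulas : Formula m a → List (Formula m a)
    subformulas φ = φ ∷ strictSubformulas φ

    strictSubformulas : Formula m a → List (Formula m a)
    strictSubformulas ⊤'             = []
    strictSubformulas (prop _)       = []
    strictSubformulas (¬' φ)         = subformulas φ
    strictSubformulas (φ ∧' ψ)       = subformulas φ ++ subformulas ψ
    strictSubformulas (⟨ _ ⟩≥ _ ∙ φ) = subformulas φ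

  ∈-subformulas-trans : ∀ {φ ψ χ} → ψ ∈ subformulas φ → χ ∈ subformulas ψ → χ ∈ subformulas φ
  ∈-subformulas-trans                (here refl)   χ∈ψ = χ∈ψ
  ∈-subformulas-trans {¬' _}         (there ψ∈φ)   χ∈ψ = there (∈-subformulas-trans ψ∈φ χ∈ψ)
  ∈-subformulas-trans {⟨ _ ⟩≥ _ ∙ _} (there ψ∈φ)   χ∈ψ = there (∈-subformulas-trans ψ∈φ χ∈ψ)
  ∈-subformulas-trans {φ ∧' _}       (there ψ∈φφ′) χ∈ψ with ∈-++⁻ (subformulas φ) ψ∈φφ′
  ... | inj₁ ψ∈φ  = there (∈-++⁺ˡ (∈-subformulas-trans ψ∈φ χ∈ψ))
  ... | inj₂ ψ∈φ′ = there (∈-++⁺ʳ (subformulas φ) (∈-subformulas-trans ψ∈φ′ χ∈ψ))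

  SameVal : (A : Model m a) → Fin (size A) → (B : Model m a) → Fin (size B) → Set
  SameVal A x B y = ∀ p → V A p x ≡ V B p y

  SameTypes : ∀ {n} → Vec (Fin a → ℕ) n →
              (A : Model m a) → Fin (size A) → (B : Model m a) → Fin (size B) → Set
  SameTypes ks A x B y = ∀ ρ → InT ks ρ → eval A ρ x ≡ eval B ρ y

  count : (K : Model m a) → Fin a → Fin (size K) → Formula m a → ℕ
  count K α k ψ = countFin (λ v → R K α k v ∧ eval K ψ v)

  module _ (K : Model m a) (k : Fin (size K)) where

    ⊨-⋀⁻ : ∀ {L} → K , k ⊨ ⋀ L → ∀ ψ → ψ ∈ L → K , k ⊨ ψ
    ⊨-⋀⁻ {ψ ∷ []}    ⊨ψ   _ (here refl)  = ⊨ψ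
    ⊨-⋀⁻ {ψ ∷ χ ∷ L} ⊨ψχL _ (here refl)  = proj₁ (to ∧≡true⇔ ⊨ψχL)
    ⊨-⋀⁻ {ψ ∷ χ ∷ L} ⊨ψχL θ (there θ∈) = ⊨-⋀⁻ (proj₂ (to ∧≡true⇔ ⊨ψχL)) θ θ∈

    ⊨-⋀⁺ : ∀ L → (∀ ψ → ψ ∈ L → K , k ⊨ ψ) → K , k ⊨ ⋀ L
    ⊨-⋀⁺ []          _  = refl
    ⊨-⋀⁺ (ψ ∷ [])    ⊨L = ⊨L ψ (here refl)
    ⊨-⋀⁺ (ψ ∷ χ ∷ L) ⊨L =
      from ∧≡true⇔ (⊨L ψ (here refl) , ⊨-⋀⁺ (χ ∷ L) (λ θ θ∈ → ⊨L θ (there θ∈)))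

    ⊨-literal⇔ : ∀ (A : Model m a) x p → (K , k ⊨ literal A x p) ⇔ (V A p x ≡ V K p k)
    ⊨-literal⇔ A x p with V A p x
    ... | true  = mk⇔ sym sym
    ... | false with V K p k
    ...   | true  = mk⇔ (λ ()) (λ ())
    ...   | false = mk⇔ (λ _ → refl) (λ _ → refl)

    ⊨-τε⇔ : ∀ (A : Model m a) x → (K , k ⊨ τε A x) ⇔ SameVal A x K k
    ⊨-τε⇔ A x = mk⇔
      (λ ⊨τε p → to (⊨-literal⇔ A x p) (⊨-⋀⁻ ⊨τε _ (∈-map⁺ (literal A x) (∈-allFin p))))
      (λ same → ⊨-⋀⁺ (map (literal A x) (allFin m)) λ ψ ψ∈ → case ∈-map⁻ (literal A x) ψ∈ of λ
        { (p , _ , refl) → from (⊨-literal⇔ A x p) (same p) })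

    ⊨-exactly⇔ : ∀ α j ψ → (K , k ⊨ (⟨ α ⟩= j ∙ ψ)) ⇔ (count K α k ψ ≡ j)
    ⊨-exactly⇔ α j ψ = exactly⇔≡ j (count K α k ψ)

    count-⊤ : ∀ α → count K α k ⊤' ≡ deg K α k
    count-⊤ α = countFin-cong (λ v → Bool.∧-identityʳ (R K α k v))

  ⋀-cong : ∀ {A B : Model m a} {x y} L → (∀ ψ → ψ ∈ L → eval A ψ x ≡ eval B ψ y) →
           eval A (⋀ L) x ≡ eval B (⋀ L) y
  ⋀-cong []          _  = refl
  ⋀-cong (ψ ∷ [])    ψ≡ = ψ≡ ψ (here refl)
  ⋀-cong (ψ ∷ χ ∷ L) ψ≡ = cong₂ _∧_ (ψ≡ ψ (here refl)) (⋀-cong (χ ∷ L) (λ θ θ∈ → ψ≡ θ (there θ∈)))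

  depth-⋀ : ∀ {b} (L : List (Formula m a)) → (∀ ψ → ψ ∈ L → depth ψ ≤ b) → depth (⋀ L) ≤ b
  depth-⋀ []          _  = z≤n
  depth-⋀ (ψ ∷ [])    ψ≤ = ψ≤ ψ (here refl)
  depth-⋀ (ψ ∷ χ ∷ L) ψ≤ = ⊔-lub (ψ≤ ψ (here refl)) (depth-⋀ (χ ∷ L) (λ θ θ∈ → ψ≤ θ (there θ∈)))

  depth-τε : ∀ (A : Model m a) x → depth (τε A x) ≤ 0
  depth-τε A x =
    depth-⋀ (map (literal A x) (allFin m)) λ ψ ψ∈ → literal-depth (∈-map⁻ (literal A x) ψ∈)
    where
    literal-depth : ∀ {ψ} → ∃ (λ p → p ∈ allFin m × ψ ≡ literal A x p) → depth ψ ≤ 0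
    literal-depth (p , _ , refl) with V A p x
    ... | true  = z≤n
    ... | false = z≤n

  eval-depth0 : ∀ {A B : Model m a} {x y} φ → depth φ ≤ 0 → SameVal A x B y → eval A φ x ≡ eval B φ y
  eval-depth0 ⊤'       _  _    = refl
  eval-depth0 (prop p) _  same = same p
  eval-depth0 (¬' φ)   d≤ same = cong not (eval-depth0 φ d≤ same)
  eval-depth0 (φ ∧' ψ) d≤ same =
    cong₂ _∧_ (eval-depth0 φ (m⊔n≤o⇒m≤o _ _ d≤) same) (eval-depth0 ψ (m⊔n≤o⇒n≤o _ _ d≤) same)

  ⊨-conjunct : ∀ {n k} {ks : Vec (Fin a → ℕ) n} {A : Model m a} {x ψ} →
               Conjunct k ks A x ψ → A , x ⊨ ψ
  ⊨-conjunct {A = A} {x} (inj₁ refl)                         = from (⊨-τε⇔ A x A x) (λ _ → refl)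
  ⊨-conjunct (inj₂ (inj₁ (_ , _ , _ , _ , _ , _ , _ , ⊨ψ)))   = ⊨ψ
  ⊨-conjunct (inj₂ (inj₂ (inj₁ (_ , _ , _ , _ , ⊨ψ))))        = ⊨ψ
  ⊨-conjunct {A = A} {x} (inj₂ (inj₂ (inj₂ (α , _ , refl)))) =
    from (⊨-exactly⇔ A x α _ ⊤') (count-⊤ A x α)

  ⊨-own-type : ∀ {n} {ks : Vec (Fin a → ℕ) n} {A : Model m a} {x σ} → IsType ks A x σ → A , x ⊨ σ
  ⊨-own-type {ks = []}    {A} {x} refl                = from (⊨-τε⇔ A x A x) (λ _ → refl)
  ⊨-own-type {ks = _ ∷ _} {A} {x} (L , _ , L⇔ , refl) =
    ⊨-⋀⁺ A x L λ ψ ψ∈L → ⊨-conjunct (to (L⇔ ψ) ψ∈L)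

  ⊨-type⇒⊨-conjunct : ∀ {n k} {ks : Vec (Fin a → ℕ) n} {A K : Model m a} {x k′ σ ψ} →
                      IsType (k ∷ ks) A x σ → K , k′ ⊨ σ → Conjunct k ks A x ψ → K , k′ ⊨ ψ
  ⊨-type⇒⊨-conjunct {K = K} {k′ = k′} {ψ = ψ} (L , _ , L⇔ , refl) ⊨σ c =
    ⊨-⋀⁻ K k′ ⊨σ ψ (from (L⇔ ψ) c)

  ⊨-type⇒SameVal : ∀ {n} {ks : Vec (Fin a → ℕ) n} {A K : Model m a} {x k σ} →
                   IsType ks A x σ → K , k ⊨ σ → SameVal A x K k
  ⊨-type⇒SameVal {ks = []}    {A} {K} {x} {k} refl ⊨σ = to (⊨-τε⇔ K k A x) ⊨σ
  ⊨-type⇒SameVal {ks = _ ∷ _} {A} {K} {x} {k} σ∈  ⊨σ =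
    to (⊨-τε⇔ K k A x) (⊨-type⇒⊨-conjunct σ∈ ⊨σ (inj₁ refl))

  depth-type : ∀ {n} (ks : Vec (Fin a → ℕ) n) {A : Model m a} {x σ} → IsType ks A x σ → depth σ ≤ n
  depth-type []       {A} {x} refl                = depth-τε A x
  depth-type (k ∷ ks) {A} {x} (L , _ , L⇔ , refl) =
    depth-⋀ L λ ψ ψ∈L → conjunct-depth (to (L⇔ ψ) ψ∈L)
    where
    conjunct-depth : ∀ {ψ} → Conjunct k ks A x ψ → depth ψ ≤ suc _
    conjunct-depth (inj₁ refl) = ≤-trans (depth-τε A x) z≤n
    conjunct-depth (inj₂ (inj₁ (_ , _ , _ , _ , _ , (_ , _ , τ∈) , refl , _))) =
      ⊔-lub (s≤s (depth-type ks τ∈)) (s≤s (depth-type ks τ∈))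
    conjunct-depth (inj₂ (inj₂ (inj₁ (_ , _ , (_ , _ , τ∈) , refl , _)))) = s≤s (depth-type ks τ∈)
    conjunct-depth (inj₂ (inj₂ (inj₂ (_ , _ , refl))))                    = ⊔-lub (s≤s z≤n) (s≤s z≤n)

  -- Finitely many types of each width

  open UniqueLists _≟ᶠ_

  τεOf : (Fin m → Bool) → Formula m a
  τεOf f = ⋀ (map (λ p → if f p then prop p else ¬' prop p) (allFin m))

  depth0Types : List (Formula m a)
  depth0Types = tabulate (τεOf ∘ decode)

  τε∈depth0Types : ∀ (A : Model m a) x → τε A x ∈ depth0Types
  τε∈depth0Types A x =
    subst (_∈ depth0Types) (cong ⋀ (map-cong literal≗ (allFin m))) (∈-tabulate⁺ (encode (λ p → V A p x)))
    where
    literal≗ : ∀ p → (if decode (encode (λ p → V A p x)) p then prop p else ¬' prop p) ≡ literal A x p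
    literal≗ p = cong (λ b → if b then prop p else ¬' prop p) (decode-encode (λ p → V A p x) p)

  modalConjuncts : (Fin a → ℕ) → List (Formula m a) → Fin a → List (Formula m a)
  modalConjuncts k T α =
    concatMap (λ ℓ → map (⟨ α ⟩= ℓ ∙_) T) (upTo (k α)) ++ map (⟨ α ⟩≥ k α ∙_) T ++
    map (λ j → ⟨ α ⟩= j ∙ ⊤') (upTo (k α))

  conjunctCandidates : (Fin a → ℕ) → List (Formula m a) → List (Formula m a)
  conjunctCandidates k T = depth0Types ++ concatMap (modalConjuncts k T) (allFin a)

  modal∈candidates : ∀ k T {ψ} α → ψ ∈ modalConjuncts k T α → ψ ∈ conjunctCandidates k T
  modal∈candidates k T α ψ∈ =
    ∈-++⁺ʳ depth0Types (∈-concat⁺′ ψ∈ (∈-map⁺ (modalConjuncts k T) (∈-allFin α)))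

  types : ∀ {n} → Vec (Fin a → ℕ) n → List (Formula m a)
  types []       = depth0Types
  types (k ∷ ks) = map ⋀ (uniqueLists (length C) C)
    where C = conjunctCandidates k (types ks)

  mutual
    InT⇒∈types : ∀ {n} (ks : Vec (Fin a → ℕ) n) {ρ} → InT ks ρ → ρ ∈ types ks
    InT⇒∈types []       (K , u , refl)               = τε∈depth0Types K u
    InT⇒∈types (k ∷ ks) (K , u , L , L! , L⇔ , refl) =
      ∈-map⁺ ⋀ (∈-uniqueLists L! (λ ψ ψ∈L → conjunct∈candidates ks (to (L⇔ ψ) ψ∈L)) ≤-refl)

    conjunct∈candidates : ∀ {n k} (ks : Vec (Fin a → ℕ) n) {A : Model m a} {x ψ} →
                          Conjunct k ks A x ψ → ψ ∈ conjunctCandidates k (types ks)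
    conjunct∈candidates ks {A} {x} (inj₁ refl) = ∈-++⁺ˡ (τε∈depth0Types A x)
    conjunct∈candidates {k = k} ks (inj₂ (inj₁ (α , ℓ , τ , _ , ℓ<k , τ∈ , refl , _))) =
      modal∈candidates k (types ks) α
        (∈-++⁺ˡ (∈-concat⁺′ (∈-map⁺ (⟨ α ⟩= ℓ ∙_) (InT⇒∈types ks τ∈)) (∈-map⁺ _ (∈-upTo⁺ ℓ<k))))
    conjunct∈candidates {k = k} ks (inj₂ (inj₂ (inj₁ (α , τ , τ∈ , refl , _)))) =
      modal∈candidates k (types ks) α
        (∈-++⁺ʳ (concatMap _ (upTo (k α))) (∈-++⁺ˡ (∈-map⁺ (⟨ α ⟩≥ k α ∙_) (InT⇒∈types ks τ∈))))
    conjunct∈candidates {k = k} ks (inj₂ (inj₂ (inj₂ (α , deg<k , refl)))) =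
      modal∈candidates k (types ks) α
        (∈-++⁺ʳ (concatMap _ (upTo (k α)))
          (∈-++⁺ʳ (map _ (types ks)) (∈-map⁺ (λ j → ⟨ α ⟩= j ∙ ⊤') (∈-upTo⁺ deg<k))))

  ¬¬-type-exists : ∀ {n} (ks : Vec (Fin a → ℕ) n) (A : Model m a) x →
                   DoubleNegation (Σ (Formula m a) (IsType ks A x))
  ¬¬-type-exists []       A x = pure (τε A x , refl)
  ¬¬-type-exists (k ∷ ks) A x = do
    (L , L⇔) ← ¬¬-filter (Conjunct k ks A x) (conjunctCandidates k (types ks))
    let L′ = deduplicate _≟ᶠ_ L
    pure (⋀ L′ , L′ , deduplicate-! _≟ᶠ_ L , (λ ψ → mk⇔
      (λ ψ∈L′ → proj₂ (to (L⇔ ψ) (∈-deduplicate⁻ _≟ᶠ_ L ψ∈L′)))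
      (λ c → ∈-deduplicate⁺ _≟ᶠ_ (from (L⇔ ψ) (conjunct∈candidates ks c , c)))) , refl)

-- Automata evaluating formulas

-- A state is the truth vector of the subformulas of φ, coded as an element of Fin (2 ^ _)
-- so that it is countable via toℕ and the states can be summed over.
module FormulaAutomaton {m a : ℕ} (φ : Formula m a) where

  lookupFormula : (χs : List (Formula m a)) → (Fin (length χs) → Bool) → Formula m a → Bool
  lookupFormula []       bs ψ = false
  lookupFormula (χ ∷ χs) bs ψ = if ⌊ χ ≟ᶠ ψ ⌋ then bs zero else lookupFormula χs (bs ∘ suc) ψ

  lookupFormula-tabulate : ∀ χs {bs} (h : Formula m a → Bool) → (∀ i → bs i ≡ h (List.lookup χs i)) →
                           ∀ {ψ} → ψ ∈ χs → lookupFormula χs bs ψ ≡ h ψ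
  lookupFormula-tabulate (χ ∷ χs) h bs≡ {ψ} ψ∈ with χ ≟ᶠ ψ
  lookupFormula-tabulate (χ ∷ χs) h bs≡ ψ∈          | yes refl = bs≡ zero
  lookupFormula-tabulate (χ ∷ χs) h bs≡ (here refl) | no χ≢ψ   = contradiction refl χ≢ψ
  lookupFormula-tabulate (χ ∷ χs) h bs≡ (there ψ∈)  | no _     = lookupFormula-tabulate χs h (bs≡ ∘ suc) ψ∈

  private
    Fs : List (Formula m a)
    Fs = subformulas φ

  State : Set
  State = Fin (2 ^ length Fs)

  holds : State → Formula m a → Bool
  holds q = lookupFormula Fs (decode q)

  store : (Formula m a → Bool) → State
  store h = encode (h ∘ List.lookup Fs)

  holds-store : ∀ h {ψ} → ψ ∈ Fs → holds (store h) ψ ≡ h ψ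
  holds-store h = lookupFormula-tabulate Fs h (decode-encode (h ∘ List.lookup Fs))

  -- Modal formulas get the junk value false: in round 0 only formulas of depth 0 are read.
  evalLocal : Subset m → Formula m a → Bool
  evalLocal S ⊤'             = true
  evalLocal S (prop p)       = Vec.lookup S p
  evalLocal S (¬' ψ)         = not (evalLocal S ψ)
  evalLocal S (ψ ∧' χ)       = evalLocal S ψ ∧ evalLocal S χ
  evalLocal S (⟨ _ ⟩≥ _ ∙ _) = false

  evalNext : (Fin a → Multiset State) → State → Formula m a → Bool
  evalNext N q ⊤'             = true
  evalNext N q (prop p)       = holds q (prop p)
  evalNext N q (¬' ψ)         = not (evalNext N q ψ)
  evalNext N q (ψ ∧' χ)       = evalNext N q ψ ∧ evalNext N q χ
  evalNext N q (⟨ α ⟩≥ k ∙ ψ) = k ≤ᵇ ∑[ q′ < 2 ^ length Fs ] (if holds q′ ψ then N α q′ else 0)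

  evalNext-cong : ∀ {N N′ : Fin a → Multiset State} q → (∀ α x → N α x ≡ N′ α x) →
                  ∀ ψ → evalNext N q ψ ≡ evalNext N′ q ψ
  evalNext-cong q N≡ ⊤'             = refl
  evalNext-cong q N≡ (prop p)       = refl
  evalNext-cong q N≡ (¬' ψ)         = cong not (evalNext-cong q N≡ ψ)
  evalNext-cong q N≡ (ψ ∧' χ)       = cong₂ _∧_ (evalNext-cong q N≡ ψ) (evalNext-cong q N≡ χ)
  evalNext-cong q N≡ (⟨ α ⟩≥ k ∙ ψ) =
    cong (k ≤ᵇ_) (sum-cong-≗ λ q′ → cong (λ n → if holds q′ ψ then n else 0) (N≡ α q′))

  automaton : CMMPA m a
  automaton = record
    { Q        = State
    ; code     = toℕ
    ; code-inj = toℕ-injective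
    ; π        = λ S → store (evalLocal S)
    ; δ        = λ N q → store (evalNext N q)
    ; δ-cong   = λ N N′ q N≡ → encode-cong (evalNext-cong q N≡ ∘ List.lookup Fs)
    ; F        = λ _ → false
    }

  received : (X : Model m a) → ℕ → Fin (size X) → Fin a → Multiset State
  received X t x α q = countFin (λ v → R X α x v ∧ ⌊ toℕ (run automaton X t v) ≟ toℕ q ⌋)

  evalLocal-correct : ∀ (X : Model m a) x ψ → depth ψ ≤ 0 →
                      evalLocal (Vec.tabulate (λ p → V X p x)) ψ ≡ eval X ψ x
  evalLocal-correct X x ⊤'       _  = refl
  evalLocal-correct X x (prop p) _  = lookup∘tabulate (λ p → V X p x) p
  evalLocal-correct X x (¬' ψ)   d≤ = cong not (evalLocal-correct X x ψ d≤)
  evalLocal-correct X x (ψ ∧' χ) d≤ =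
    cong₂ _∧_ (evalLocal-correct X x ψ (m⊔n≤o⇒m≤o _ _ d≤)) (evalLocal-correct X x χ (m⊔n≤o⇒n≤o _ _ d≤))

  module _ (X : Model m a) (t : ℕ)
           (IH : ∀ y {ψ} → ψ ∈ Fs → depth ψ ≤ t → holds (run automaton X t y) ψ ≡ eval X ψ y) where

    evalNext-correct : ∀ x {ψ} → ψ ∈ Fs → depth ψ ≤ suc t →
                       evalNext (received X t x) (run automaton X t x) ψ ≡ eval X ψ x
    evalNext-correct x {⊤'}           _  _  = refl
    evalNext-correct x {prop p}       ψ∈ _  = IH x ψ∈ z≤n
    evalNext-correct x {¬' ψ}         ψ∈ d≤ =
      cong not (evalNext-correct x (∈-subformulas-trans ψ∈ (there (here refl))) d≤)
    evalNext-correct x {ψ ∧' χ}       ψ∈ d≤ =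
      cong₂ _∧_ (evalNext-correct x (∈-subformulas-trans ψ∈ (there (here refl))) (m⊔n≤o⇒m≤o _ _ d≤))
                (evalNext-correct x (∈-subformulas-trans ψ∈ (there (∈-++⁺ʳ (subformulas ψ) (here refl))))
                                    (m⊔n≤o⇒n≤o _ _ d≤))
    evalNext-correct x {⟨ α ⟩≥ k ∙ ψ} ψ∈ d≤ = cong (k ≤ᵇ_) (begin
      ∑[ q < 2 ^ length Fs ] (if holds q ψ then received X t x α q else 0)
        ≡⟨ count-by-state (R X α x) (run automaton X t) (λ q → holds q ψ) ⟩
      countFin (λ v → R X α x v ∧ holds (run automaton X t v) ψ)
        ≡⟨ countFin-cong (λ v → cong (R X α x v ∧_) (IH v ψ∈Fs (≤-pred d≤))) ⟩
      countFin (λ v → R X α x v ∧ eval X ψ v) ∎)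
      where
      open ≡-Reasoning
      ψ∈Fs = ∈-subformulas-trans ψ∈ (there (here refl))

  holds-run : ∀ (X : Model m a) t x {ψ} → ψ ∈ Fs → depth ψ ≤ t →
              holds (run automaton X t x) ψ ≡ eval X ψ x
  holds-run X zero    x {ψ} ψ∈ d≤ =
    trans (holds-store (evalLocal (Vec.tabulate (λ p → V X p x))) ψ∈) (evalLocal-correct X x ψ d≤)
  holds-run X (suc t) x     ψ∈ d≤ =
    trans (holds-store (evalNext (received X t x) (run automaton X t x)) ψ∈)
          (evalNext-correct X t (holds-run X t) x ψ∈ d≤)

runs⇒≡eval : ∀ {m a n} {M N : Model m a} {w v} → (∀ (A : CMMPA m a) → run A M n w ≡ run A N n v) →
             ∀ φ → depth φ ≤ n → eval M φ w ≡ eval N φ v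
runs⇒≡eval {n = n} {M} {N} {w} {v} sameRuns φ d≤n = begin
  eval M φ w                      ≡⟨ holds-run M n w (here refl) d≤n ⟨
  holds (run automaton M n w) φ   ≡⟨ cong (λ q → holds q φ) (sameRuns automaton) ⟩
  holds (run automaton N n v) φ   ≡⟨ holds-run N n v (here refl) d≤n ⟩
  eval N φ v                      ∎
  where
  open FormulaAutomaton φ
  open ≡-Reasoning

-- Types determine runs

module TypesDetermineRuns {m a : ℕ} (M : Model m a)
                          (bound : Fin a → ℕ) (deg<bound : ∀ α x → deg M α x < bound α) where

  widths : ∀ d → Vec (Fin a → ℕ) d
  widths d = Vec.replicate d bound

  fullType : ∀ {n x σ} → IsType (widths n) M x σ → FullType n M x σ
  fullType {n} σ∈ = widths n , (λ i α u _ → subst (deg M α u <_) (bound≡ i α) (deg<bound α u)) , σ∈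
    where
    bound≡ : ∀ i α → bound α ≡ Vec.lookup (widths n) i α
    bound≡ i α = sym (cong (_$ α) (lookup-replicate i bound))

  Characteristic : ℕ → Set
  Characteristic d = ∀ {x σ} → IsType (widths d) M x σ →
                     ∀ (K : Model m a) k → K , k ⊨ σ → SameTypes (widths d) M x K k

  TypeInvariant : ℕ → ((K : Model m a) → Fin (size K) → Bool) → Set
  TypeInvariant d G = ∀ {x σ} → IsType (widths d) M x σ → ∀ (K : Model m a) k → K , k ⊨ σ → G K k ≡ G M x

  types-overlap : ∀ {d} → Characteristic d →
                  ∀ {x₁ x₂ σ₁ σ₂} → IsType (widths d) M x₁ σ₁ → IsType (widths d) M x₂ σ₂ →
                  ∀ {K : Model m a} {k} → K , k ⊨ σ₁ → K , k ⊨ σ₂ → M , x₂ ⊨ σ₁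
  types-overlap char {x₁} {σ₁ = σ₁} σ₁∈ σ₂∈ {K} {k} ⊨σ₁ ⊨σ₂ =
    trans (char σ₂∈ K k ⊨σ₂ σ₁ (M , x₁ , σ₁∈)) ⊨σ₁

  neighbour-count : ∀ {d} → Characteristic d → ∀ {x σ} → IsType (widths (suc d)) M x σ →
                    ∀ (B : Model m a) y → B , y ⊨ σ → ∀ G → TypeInvariant d G →
                    ∀ α → countFin (λ v → R M α x v ∧ G M v) ≡ countFin (λ v → R B α y v ∧ G B v)
  neighbour-count {d} char {x} σ∈ B y ⊨σ G G-inv α = decidable-stable (_ ≟ _) do
    τ ← ¬¬-finite-choice (size M) (¬¬-type-exists (widths d) M)
    pure (count-by-types (proj₁ ∘ τ) (proj₂ ∘ τ))
    where
    count-by-types : (τ : Fin (size M) → Formula m a) → (∀ z → IsType (widths d) M z (τ z)) →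
                     countFin (λ v → R M α x v ∧ G M v) ≡ countFin (λ v → R B α y v ∧ G B v)
    count-by-types τ τ∈ =
      count-classes (countFin (R M α x)) (R M α x) (R B α y) ≤-refl same-degree same-class-sizes
      where
      open ClassCounting (λ z → eval M (τ z)) (λ z → eval B (τ z)) (λ z → ⊨-own-type (τ∈ z))
        (types-overlap char (τ∈ _) (τ∈ _)) (types-overlap char (τ∈ _) (τ∈ _))
        (G M) (G B) (λ {z} {z′} → G-inv (τ∈ z) M z′) (λ {z} {y′} → G-inv (τ∈ z) B y′)

      same-degree : countFin (R M α x) ≡ countFin (R B α y)
      same-degree = begin
        countFin (R M α x)  ≡⟨ to (⊨-exactly⇔ B y α _ ⊤') (⊨-type⇒⊨-conjunct σ∈ ⊨σ degree-conjunct) ⟨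
        count B α y ⊤'      ≡⟨ count-⊤ B y α ⟩
        countFin (R B α y)  ∎
        where
        open ≡-Reasoning
        degree-conjunct = inj₂ (inj₂ (inj₂ (α , deg<bound α x , refl)))

      same-class-sizes : ∀ z → R M α x z ≡ true → count M α x (τ z) ≡ count B α y (τ z)
      same-class-sizes z Rxz = sym (to (⊨-exactly⇔ B y α c (τ z)) (⊨-type⇒⊨-conjunct σ∈ ⊨σ conjunct))
        where
        c = count M α x (τ z)
        conjunct : Conjunct bound (widths d) M x (⟨ α ⟩= c ∙ τ z)
        conjunct = inj₂ (inj₁ (α , c , τ z ,
          countFin-pos (λ v → R M α x v ∧ eval M (τ z) v) (from ∧≡true⇔ (Rxz , ⊨-own-type (τ∈ z))) ,
          ≤-<-trans (countFin-∩-≤ (R M α x) (eval M (τ z))) (deg<bound α x) ,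
          (M , z , τ∈ z) , refl , from (⊨-exactly⇔ M x α c (τ z)) refl))

  characteristic : ∀ d → Characteristic d
  characteristic zero {x} σ∈ K k ⊨σ ρ (K′ , u , refl) =
    eval-depth0 (τε K′ u) (depth-τε K′ u) (⊨-type⇒SameVal {A = M} {x = x} σ∈ ⊨σ)
  characteristic (suc d) {x} σ∈ K k ⊨σ ρ (K′ , u , L , _ , L⇔ , refl) =
    ⋀-cong L λ ψ ψ∈L → conjunct-agrees (to (L⇔ ψ) ψ∈L)
    where
    counts : ∀ G → TypeInvariant d G →
             ∀ α → countFin (λ v → R M α x v ∧ G M v) ≡ countFin (λ v → R K α k v ∧ G K v)
    counts = neighbour-count (characteristic d) σ∈ K k ⊨σ
    evalInvariant : ∀ {τ} → InT (widths d) τ → TypeInvariant d (λ K k → eval K τ k)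
    evalInvariant τ∈ σ′∈ K k ⊨σ′ = sym (characteristic d σ′∈ K k ⊨σ′ _ τ∈)
    conjunct-agrees : ∀ {ψ} → Conjunct bound (widths d) K′ u ψ → eval M ψ x ≡ eval K ψ k
    conjunct-agrees (inj₁ refl) = eval-depth0 (τε K′ u) (depth-τε K′ u) (⊨-type⇒SameVal σ∈ ⊨σ)
    conjunct-agrees (inj₂ (inj₁ (α , ℓ , τ , _ , _ , τ∈ , refl , _))) =
      cong (λ c → (ℓ ≤ᵇ c) ∧ not (suc ℓ ≤ᵇ c)) (counts _ (evalInvariant τ∈) α)
    conjunct-agrees (inj₂ (inj₂ (inj₁ (α , τ , τ∈ , refl , _)))) =
      cong (bound α ≤ᵇ_) (counts _ (evalInvariant τ∈) α)
    conjunct-agrees (inj₂ (inj₂ (inj₂ (α , _ , refl)))) =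
      cong (λ c → (deg K′ α u ≤ᵇ c) ∧ not (suc (deg K′ α u) ≤ᵇ c))
           (counts (λ _ _ → true) (λ _ _ _ _ → refl) α)

  run-determined : ∀ (A : CMMPA m a) {t d} → t ≤ d → ∀ {x σ} → IsType (widths d) M x σ →
                   ∀ (K : Model m a) k → K , k ⊨ σ → run A M t x ≡ run A K t k
  run-determined A {zero} _ σ∈ K k ⊨σ = cong (π A) (tabulate-cong (⊨-type⇒SameVal σ∈ ⊨σ))
  run-determined A {suc t} {suc d} (s≤s t≤d) σ∈ K k ⊨σ =
    trans (δ-cong A _ _ _ λ α q →
             neighbour-count (characteristic d) σ∈ K k ⊨σ (inState q) (inState-invariant q) α)
          (cong (δ A _) (run-determined A (m≤n⇒m≤1+n t≤d) σ∈ K k ⊨σ))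
    where
    inState : Q A → (K : Model m a) → Fin (size K) → Bool
    inState q K k = ⌊ code A (run A K t k) ≟ code A q ⌋
    inState-invariant : ∀ q → TypeInvariant d (inState q)
    inState-invariant q σ′∈ K k ⊨σ′ =
      cong (λ r → ⌊ code A r ≟ code A q ⌋) (sym (run-determined A t≤d σ′∈ K k ⊨σ′))

CMMPA-≟ : ∀ {m a} (A : CMMPA m a) → DecidableEquality (Q A)
CMMPA-≟ A q q′ = map′ (code-inj A) (cong (code A)) (code A q ≟ code A q′)

lemma2 : ∀ (m a n : ℕ) (M : Model m (suc a)) (w : Fin (size M)) (N : Model m (suc a)) (v : Fin (size N)) →
           SameFullTypes n M w N v ⇔
           (∀ (A : CMMPA m (suc a)) (t : ℕ) → t ≤ n → run A M t w ≡ run A N t v)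
lemma2 m a n M w N v = mk⇔ types⇒runs runs⇒types
  where
  open TypesDetermineRuns M (λ _ → suc (size M)) (λ α x → s≤s (countFin-≤ (R M α x)))

  types⇒runs : SameFullTypes n M w N v → ∀ A t → t ≤ n → run A M t w ≡ run A N t v
  types⇒runs sameTypes A t t≤n = decidable-stable (CMMPA-≟ A _ _) do
    (σ , σ∈) ← ¬¬-type-exists (widths n) M w
    pure (run-determined A t≤n σ∈ N v (to (sameTypes σ (M , w , fullType σ∈)) (⊨-own-type σ∈)))

  runs⇒types : (∀ A t → t ≤ n → run A M t w ≡ run A N t v) → SameFullTypes n M w N v
  runs⇒types sameRuns φ (K , u , ks , _ , φ∈) = mk⇔ (trans (sym agree)) (trans agree)
    where
    agree : eval M φ w ≡ eval N φ v
    agree = runs⇒≡eval (λ A → sameRuns A n ≤-refl) φ (depth-type ks φ∈)
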